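{- Let $d\geq 2$ and let $G_{l_1,\ldots,l_d}=P_{l_1}\square P_{l_2}\square\cdots\square P_{l_d}$ with integers $l_1,\ldots,l_d\geq 2$. Then $\chi'_s(G_{l_1,\ldots,l_d})\leq 4d-2$. Moreover, for $d=2$ and $l_1,l_2\geq 4$ this bound is attained, i.e. $\chi'_s(P_{l_1}\square P_{l_2})=6$.
   Context: $P_n$ is the path on $n$ vertices. A star edge coloring of a graph is a proper edge coloring such that no path or cycle with four edges uses at most two colors; $\chi'_s(G)$ is the minimum number of colors in a star edge coloring of $G$. The Cartesian product $G\square H$ has vertex set $V(G)\times V(H)$, with $(a,x)(b,y)$ an edge iff either $ab\in E(G)$ and $x=y$, or $xy\in E(H)$ and $a=b$. -}

module Defs where

open import Data.Nat using (ℕ; suc; _<_; _≤_)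
open import Data.Fin using (Fin)
open import Data.Vec using (Vec; lookup)
open import Data.Vec.Relation.Binary.Pointwise.Inductive using (Pointwise)
open import Data.Product using (Σ; ∃; ∃-syntax; _×_)
open import Data.Sum using (_⊎_)
open import Relation.Binary.PropositionalEquality using (_≡_; _≢_)
open import Relation.Nullary using (¬_)

-- P_l has vertex set {0,...,l-1} with i ~ i+1.  Iterating the Cartesian
-- product, the vertices are tuples x = (x_1,...,x_d) with x_i < l_i, and
-- x ~ y iff they differ in exactly one coordinate i, where |x_i - y_i| = 1.
-- Vertices are represented as vectors in Vec ℕ d satisfying InGrid.

InGrid : ∀ {d} → Vec ℕ d → Vec ℕ d → Set
InGrid l x = Pointwise _<_ x l

PathAdj : ℕ → ℕ → Set
PathAdj a b = suc a ≡ b ⊎ suc b ≡ a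

Adj : ∀ {d} → Vec ℕ d → Vec ℕ d → Vec ℕ d → Set
Adj {d} l x y =
  InGrid l x × InGrid l y ×
  ∃[ i ] (PathAdj (lookup x i) (lookup y i) ×
          (∀ (j : Fin d) → j ≢ i → lookup x j ≡ lookup y j))

-- Edge colorings with k colors: c assigns a color c x y to each pair;
-- only its values on edges matter, and it must be well defined on the
-- (unordered) edge xy, i.e. symmetric on adjacent pairs.

record IsStarEdgeColoring {d} (l : Vec ℕ d) (k : ℕ)
                          (c : Vec ℕ d → Vec ℕ d → Fin k) : Set where
  field
    symmetric : ∀ x y → Adj l x y → c x y ≡ c y x
    proper    : ∀ x y z → Adj l x y → Adj l x z → y ≢ z → c x y ≢ c x z
    -- no path or cycle with four edges v0 v1 v2 v3 v4 uses at most two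
    -- colors.  v0..v3 pairwise distinct, v4 distinct from v1,v2,v3;
    -- v4 = v0 gives a 4-cycle, v4 ≢ v0 gives a path with four edges.
    star : ∀ v0 v1 v2 v3 v4 →
           Adj l v0 v1 → Adj l v1 v2 → Adj l v2 v3 → Adj l v3 v4 →
           v0 ≢ v1 → v0 ≢ v2 → v0 ≢ v3 → v1 ≢ v2 → v1 ≢ v3 → v2 ≢ v3 →
           v4 ≢ v1 → v4 ≢ v2 → v4 ≢ v3 →
           ¬ (Σ (Fin k) λ a → Σ (Fin k) λ b →
                (c v0 v1 ≡ a ⊎ c v0 v1 ≡ b) ×
                (c v1 v2 ≡ a ⊎ c v1 v2 ≡ b) ×
                (c v2 v3 ≡ a ⊎ c v2 v3 ≡ b) ×
                (c v3 v4 ≡ a ⊎ c v3 v4 ≡ b))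

StarColorable : ∀ {d} → Vec ℕ d → ℕ → Set
StarColorable {d} l k = Σ (Vec ℕ d → Vec ℕ d → Fin k) (IsStarEdgeColoring l k)

StarChromaticIndex : ∀ {d} → Vec ℕ d → ℕ → Set
StarChromaticIndex l k = StarColorable l k × (∀ m → StarColorable l m → k ≤ m)

module Submission where

-- Colour the edge from x to x + eᵢ by (i , Φᵢ x mod 3), where
-- Φᵢ x = Σⱼ xⱼ + Σ_{j<i} xⱼ.  A step in direction j changes Φᵢ by ±wᵢⱼ, with
-- wᵢⱼ = 2 if j < i and 1 otherwise.  Equal colours force equal directions, and
-- tracking Φᵢ mod 3 along a walk e₁ e₂ e₃ whose outer edges share a colour shows
-- that e₂ is oriented like its neighbours iff wᵢⱼ = 2.  A bichromatic path
-- e₁ e₂ e₃ e₄ in directions i, j, i, j would then need wᵢⱼ = wⱼᵢ, i.e. i = j, and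
-- then it backtracks.  So 3d colours suffice, which is at most 4d − 2; and as star
-- colourability of a finite grid is decidable, χ'ₛ exists.
--
-- P₄ □ P₄ has no star edge colouring with 5 colours: an exhaustive
-- search over colourings in canonical form (every edge takes a colour already used
-- or the least unused one) finds none, and the search is complete because star
-- colourings stay star colourings when the colours are permuted.

open import Defs
open import Algebra.Properties.CommutativeSemigroup using (x∙yz≈y∙xz)
open import Data.Bool using (Bool; true; false; not; T; _∧_; _∨_; if_then_else_)
open import Data.Empty using (⊥; ⊥-elim)
open import Data.Fin as Fin using (Fin; zero; suc; toℕ; fromℕ<; inject≤; combine)
open import Data.Fin.Permutation.Components using (transpose; transpose-inverse)
open import Data.Fin.Properties
  using (any?; all?; ¬Fin0; toℕ<n; toℕ-fromℕ<; inject≤-injective; combine-injective; <-cmp)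
import Data.Fin.Properties as Fin
open import Data.List as List using (List; []; _∷_; _++_; map; concatMap; filterᵇ; upTo; length)
open import Data.List.Relation.Unary.All as ListAll using ([]; _∷_)
open import Data.Maybe as Maybe using (Maybe; just; nothing; fromMaybe)
open import Data.Nat as ℕ
  using (ℕ; zero; suc; _+_; _*_; _∸_; _⊓_; _⊔_; _≤_; _<_; _≤?_; _<?_; _<ᵇ_; _≡ᵇ_; s≤s)
open import Data.Nat.Induction using (<-rec)
open import Data.Nat.Properties
  using ( *-suc; *-comm; +-assoc; +-commutativeSemigroup; 1+n≢n; n≤1+n; m≤n+m; ⊓-idem
        ; m≤n⇒m⊓n≡m; m≥n⇒m⊓n≡n; m≤n⇒m≤n⊔o; m≤n⇒m≤o⊔n; allUpTo?; anyUpTo?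
        ; ≤-refl; ≤-reflexive; ≤-trans; ≤-pred; <⇒≤; <-≤-trans; <-trans; <-irrefl; <-asym
        ; ≮⇒≥; ≰⇒>; m≤n⇒m<n∨m≡n )
open import Data.Product using (Σ; ∃-syntax; _×_; _,_; proj₁; proj₂)
import Data.Product.Properties as Product
open import Data.Sum as Sum using (_⊎_; inj₁; inj₂)
open import Data.Unit using (⊤; tt)
open import Data.Vec using (Vec; []; _∷_; lookup; tabulate; replicate; zipWith; _[_]%=_)
open import Data.Vec.Properties
  using ( ∷-injective; lookup∘updateAt; lookup∘updateAt′; lookup∘tabulate; tabulate∘lookup
        ; tabulate-cong; zipWith-idem )
  renaming (≡-dec to ≡-dec-Vec)
open import Data.Vec.Relation.Binary.Pointwise.Inductive as Pointwise using (Pointwise; []; _∷_)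
open import Data.Vec.Relation.Unary.All using (All)
open import Function using (_∘_)
open import Relation.Binary using (tri<; tri≈; tri>)
open import Relation.Binary.PropositionalEquality
open import Relation.Nullary using (¬_; Dec; yes; no; does; isYes; contradiction)
open import Relation.Nullary.Decidable
  using (map′; _×-dec_; _⊎-dec_; _→-dec_; ¬?; toWitness; dec-true; dec-false)

private variable
  A : Set
  n : ℕ
  l v₀ v₁ v₂ v₃ v₄ x y z : Vec ℕ n

StarCondition : (l : Vec ℕ n) (k : ℕ) → (Vec ℕ n → Vec ℕ n → Fin k) → Set
StarCondition l k c =
  ∀ v₀ v₁ v₂ v₃ v₄ → Adj l v₀ v₁ → Adj l v₁ v₂ → Adj l v₂ v₃ → Adj l v₃ v₄ →
  v₀ ≢ v₁ → v₀ ≢ v₂ → v₀ ≢ v₃ → v₁ ≢ v₂ → v₁ ≢ v₃ → v₂ ≢ v₃ → v₄ ≢ v₁ → v₄ ≢ v₂ → v₄ ≢ v₃ →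
  ¬ (Σ (Fin k) λ a → Σ (Fin k) λ b →
       (c v₀ v₁ ≡ a ⊎ c v₀ v₁ ≡ b) × (c v₁ v₂ ≡ a ⊎ c v₁ v₂ ≡ b) ×
       (c v₂ v₃ ≡ a ⊎ c v₂ v₃ ≡ b) × (c v₃ v₄ ≡ a ⊎ c v₃ v₄ ≡ b))

Adj-sym : Adj l x y → Adj l y x
Adj-sym (x∈l , y∈l , i , step , same) = y∈l , x∈l , i , Sum.swap step , λ j j≢i → sym (same j j≢i)

Adj-mono : ∀ {l′ : Vec ℕ n} → Pointwise _≤_ l l′ → Adj l x y → Adj l′ x y
Adj-mono l≤l′ (x∈l , y∈l , rest) =
  Pointwise.trans <-≤-trans x∈l l≤l′ , Pointwise.trans <-≤-trans y∈l l≤l′ , rest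

IsStarEdgeColoring-mono : ∀ {l′ : Vec ℕ n} {k c} → Pointwise _≤_ l l′ →
                          IsStarEdgeColoring l′ k c → IsStarEdgeColoring l k c
IsStarEdgeColoring-mono l≤l′ isStar = record
  { symmetric = λ x y xy → symmetric x y (Adj-mono l≤l′ xy)
  ; proper    = λ x y z xy xz → proper x y z (Adj-mono l≤l′ xy) (Adj-mono l≤l′ xz)
  ; star      = λ v₀ v₁ v₂ v₃ v₄ a₀₁ a₁₂ a₂₃ a₃₄ →
      star v₀ v₁ v₂ v₃ v₄ (Adj-mono l≤l′ a₀₁) (Adj-mono l≤l′ a₁₂) (Adj-mono l≤l′ a₂₃) (Adj-mono l≤l′ a₃₄)
  }
  where open IsStarEdgeColoring isStar

covered-by-distinct-pair : ∀ {a b p q r : A} → p ≡ a ⊎ p ≡ b → q ≡ a ⊎ q ≡ b → p ≢ q →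
                           r ≡ a ⊎ r ≡ b → r ≡ p ⊎ r ≡ q
covered-by-distinct-pair (inj₁ refl) (inj₁ refl) p≢q _    = ⊥-elim (p≢q refl)
covered-by-distinct-pair (inj₂ refl) (inj₂ refl) p≢q _    = ⊥-elim (p≢q refl)
covered-by-distinct-pair (inj₁ refl) (inj₂ refl) _   r∈ab = r∈ab
covered-by-distinct-pair (inj₂ refl) (inj₁ refl) _   r∈ab = Sum.swap r∈ab

alternates : ∀ {a b p q r : A} → p ≡ a ⊎ p ≡ b → q ≡ a ⊎ q ≡ b → r ≡ a ⊎ r ≡ b →
             p ≢ q → q ≢ r → p ≡ r
alternates p∈ab q∈ab r∈ab p≢q q≢r with covered-by-distinct-pair p∈ab q∈ab p≢q r∈ab
... | inj₁ r≡p = sym r≡p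
... | inj₂ r≡q = ⊥-elim (q≢r (sym r≡q))

StarColorable-mono : ∀ {n} {l : Vec ℕ n} {m k} → m ≤ k → StarColorable l m → StarColorable l k
StarColorable-mono {n} {l} {m} {k} m≤k (c , isStar) = widened , record
  { symmetric = λ x y xy → cong (λ e → inject≤ e m≤k) (symmetric x y xy)
  ; proper    = λ x y z xy xz y≢z eq → proper x y z xy xz y≢z (injective eq)
  ; star      = star′
  }
  where
  open IsStarEdgeColoring isStar
  widened : Vec ℕ n → Vec ℕ n → Fin k
  widened x y = inject≤ (c x y) m≤k
  injective : ∀ {e f} → inject≤ e m≤k ≡ inject≤ f m≤k → e ≡ f
  injective = inject≤-injective m≤k m≤k _ _
  star′ : StarCondition l k widened
  star′ v₀ v₁ v₂ v₃ v₄ a₀₁ a₁₂ a₂₃ a₃₄ n₀₁ n₀₂ n₀₃ n₁₂ n₁₃ n₂₃ n₄₁ n₄₂ n₄₃ (a , b , m₁ , m₂ , m₃ , m₄) =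
    star v₀ v₁ v₂ v₃ v₄ a₀₁ a₁₂ a₂₃ a₃₄ n₀₁ n₀₂ n₀₃ n₁₂ n₁₃ n₂₃ n₄₁ n₄₂ n₄₃
         (c v₀ v₁ , c v₁ v₂ , inj₁ refl , inj₂ refl , pull m₃ , pull m₄)
    where
    c₀₁≢c₁₂ : c v₀ v₁ ≢ c v₁ v₂
    c₀₁≢c₁₂ eq = proper v₁ v₀ v₂ (Adj-sym a₀₁) a₁₂ n₀₂ (trans (sym (symmetric v₀ v₁ a₀₁)) eq)
    pull : ∀ {e} → inject≤ e m≤k ≡ a ⊎ inject≤ e m≤k ≡ b → e ≡ c v₀ v₁ ⊎ e ≡ c v₁ v₂
    pull e∈ab = Sum.map injective injective (covered-by-distinct-pair m₁ m₂ (c₀₁≢c₁₂ ∘ injective) e∈ab)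

_↑_ : Vec ℕ n → Fin n → Vec ℕ n
x ↑ i = x [ i ]%= suc

↑-injective : ∀ i → x ↑ i ≡ y ↑ i → x ≡ y
↑-injective {x = a ∷ x} {b ∷ y} zero    eq with ∷-injective eq
... | refl , refl = refl
↑-injective {x = a ∷ x} {b ∷ y} (suc i) eq with ∷-injective eq
... | refl , eq′ = cong (a ∷_) (↑-injective i eq′)

lookup-extensionality : (∀ i → lookup x i ≡ lookup y i) → x ≡ y
lookup-extensionality {x = x} {y} eq =
  trans (sym (tabulate∘lookup x)) (trans (tabulate-cong eq) (tabulate∘lookup y))

↑-from-lookups : ∀ i → suc (lookup x i) ≡ lookup y i →
                 (∀ j → j ≢ i → lookup x j ≡ lookup y j) → y ≡ x ↑ i
↑-from-lookups {x = x} {y} i at-i elsewhere = lookup-extensionality agree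
  where
  agree : ∀ j → lookup y j ≡ lookup (x ↑ i) j
  agree j with j Fin.≟ i
  ... | yes refl = trans (sym at-i) (sym (lookup∘updateAt i x))
  ... | no j≢i   = trans (sym (elsewhere j j≢i)) (sym (lookup∘updateAt′ j i j≢i x))

Moves : Fin n → Bool → Vec ℕ n → Vec ℕ n → Set
Moves i true  x y = y ≡ x ↑ i
Moves i false x y = x ≡ y ↑ i

record Step (x y : Vec ℕ n) : Set where
  constructor step
  field
    direction : Fin n
    ascending : Bool
    moves     : Moves direction ascending x y
open Step

adj⇒step : ∀ {l : Vec ℕ n} → Adj l x y → Step x y
adj⇒step (_ , _ , i , inj₁ up   , same) = step i true  (↑-from-lookups i up same)
adj⇒step (_ , _ , i , inj₂ down , same) = step i false (↑-from-lookups i down λ j j≢i → sym (same j j≢i))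

reverse : Step x y → Step y x
reverse (step i true  m) = step i false m
reverse (step i false m) = step i true  m

lower : {x y : Vec ℕ n} → Step x y → Vec ℕ n
lower {x = x} (step _ true  _) = x
lower {y = y} (step _ false _) = y

backtracks : (s : Step x y) (t : Step y z) → direction s ≡ direction t →
             ascending s ≢ ascending t → x ≡ z
backtracks (step i true  refl) (step .i false eq)   refl _  = ↑-injective i eq
backtracks (step i false refl) (step .i true  refl) refl _  = refl
backtracks (step i true  _)    (step .i true  _)    refl ≠ = ⊥-elim (≠ refl)
backtracks (step i false _)    (step .i false _)    refl ≠ = ⊥-elim (≠ refl)

-- Potentials

heavy : Fin n → Fin n → Bool
heavy i j = does (j Fin.<? i)

heavy-irrefl : ∀ (i : Fin n) → heavy i i ≡ false
heavy-irrefl i = dec-false (i Fin.<? i) (Fin.<-irrefl refl)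

heavy-flip : ∀ {i j : Fin n} → i ≢ j → heavy j i ≡ not (heavy i j)
heavy-flip {i = i} {j} i≢j with <-cmp i j
... | tri< i<j _ _ = trans (dec-true (i Fin.<? j) i<j) (cong not (sym (dec-false (j Fin.<? i) (<-asym i<j))))
... | tri≈ _ i≡j _ = ⊥-elim (i≢j i≡j)
... | tri> _ _ j<i = trans (dec-false (i Fin.<? j) (<-asym j<i)) (cong not (sym (dec-true (j Fin.<? i) j<i)))

coefficient : Bool → ℕ
coefficient false = 1
coefficient true  = 2

_·_ : Vec ℕ n → Vec ℕ n → ℕ
[]      · []      = 0
(a ∷ w) · (b ∷ x) = a * b + w · x

·-↑ : ∀ (w x : Vec ℕ n) i → w · (x ↑ i) ≡ lookup w i + w · x
·-↑ (a ∷ w) (b ∷ x) zero    = trans (cong (_+ w · x) (*-suc a b)) (+-assoc a (a * b) (w · x))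
·-↑ (a ∷ w) (b ∷ x) (suc i) =
  trans (cong (a * b +_) (·-↑ w x i)) (x∙yz≈y∙xz +-commutativeSemigroup (a * b) (lookup w i) (w · x))

potential : Fin n → Vec ℕ n → ℕ
potential i x = tabulate (coefficient ∘ heavy i) · x

potential-↑ : ∀ k (x : Vec ℕ n) i → potential k (x ↑ i) ≡ coefficient (heavy k i) + potential k x
potential-↑ k x i = trans (·-↑ weights x i) (cong (_+ potential k x) (lookup∘tabulate (coefficient ∘ heavy k) i))
  where
  weights : Vec ℕ _
  weights = tabulate (coefficient ∘ heavy k)

Rise : ℕ → Bool → ℕ → ℕ → Set
Rise w true  p q = q ≡ w + p
Rise w false p q = p ≡ w + q

low : Bool → ℕ → ℕ → ℕ
low true  p _ = p
low false _ q = q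

potential-rise : ∀ k (s : Step x y) →
                 Rise (coefficient (heavy k (direction s))) (ascending s) (potential k x) (potential k y)
potential-rise k (step i true  refl) = potential-↑ k _ i
potential-rise k (step i false refl) = potential-↑ k _ i

potential-lower : ∀ k (s : Step x y) →
                  potential k (lower s) ≡ low (ascending s) (potential k x) (potential k y)
potential-lower k (step _ true  _) = refl
potential-lower k (step _ false _) = refl

own-potential-rise : (s : Step x y) →
                     Rise 1 (ascending s) (potential (direction s) x) (potential (direction s) y)
own-potential-rise {x = x} {y} s@(step i _ _) =
  subst (λ h → Rise (coefficient h) (ascending s) (potential i x) (potential i y))
        (heavy-irrefl i) (potential-rise i s)

rotate : Fin 3 → Fin 3
rotate zero          = suc zero
rotate (suc zero)    = suc (suc zero)
rotate (suc (suc _)) = zero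

residue : ℕ → Fin 3
residue zero    = zero
residue (suc p) = rotate (residue p)

rotate-no-fixpoint : ∀ r → r ≢ rotate r
rotate-no-fixpoint zero          ()
rotate-no-fixpoint (suc zero)    ()
rotate-no-fixpoint (suc (suc zero)) ()

rotate²-no-fixpoint : ∀ r → r ≢ rotate (rotate r)
rotate²-no-fixpoint zero          ()
rotate²-no-fixpoint (suc zero)    ()
rotate²-no-fixpoint (suc (suc zero)) ()

AgreeIff : Bool → Bool → Bool → Set
AgreeIff true  s s′ = s ≡ s′
AgreeIff false s s′ = s ≢ s′

AgreeIff-not : ∀ {h s s′} → AgreeIff h s s′ → AgreeIff (not h) s s′ → ⊥
AgreeIff-not {true}  same differ = differ same
AgreeIff-not {false} differ same = differ same

congruent-unit-rises⇒opposite : ∀ {s₁ s₂ p₀ p₁ p₂} → Rise 1 s₁ p₀ p₁ → Rise 1 s₂ p₁ p₂ →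
                                residue (low s₁ p₀ p₁) ≡ residue (low s₂ p₁ p₂) → s₁ ≢ s₂
congruent-unit-rises⇒opposite {true}  {true}  refl refl e = λ _ → rotate-no-fixpoint _ e
congruent-unit-rises⇒opposite {false} {false} refl refl e = λ _ → rotate-no-fixpoint _ (sym e)
congruent-unit-rises⇒opposite {true}  {false} _    _    _ = λ ()
congruent-unit-rises⇒opposite {false} {true}  _    _    _ = λ ()

congruent-outer-rises : ∀ {h s₁ s₂ s₃ p₀ p₁ p₂ p₃} →
                        Rise 1 s₁ p₀ p₁ → Rise (coefficient h) s₂ p₁ p₂ → Rise 1 s₃ p₂ p₃ →
                        residue (low s₁ p₀ p₁) ≡ residue (low s₃ p₂ p₃) → AgreeIff h s₁ s₂ × AgreeIff h s₂ s₃
congruent-outer-rises {false} {true}  {true}  {true}  refl refl refl e = ⊥-elim (rotate²-no-fixpoint _ e)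
congruent-outer-rises {false} {true}  {true}  {false} refl refl refl e = ⊥-elim (rotate-no-fixpoint _ e)
congruent-outer-rises {false} {true}  {false} {true}  refl refl refl e = (λ ()) , (λ ())
congruent-outer-rises {false} {true}  {false} {false} refl refl refl e = ⊥-elim (rotate-no-fixpoint _ (sym e))
congruent-outer-rises {false} {false} {true}  {true}  refl refl refl e = ⊥-elim (rotate-no-fixpoint _ e)
congruent-outer-rises {false} {false} {true}  {false} refl refl refl e = (λ ()) , (λ ())
congruent-outer-rises {false} {false} {false} {true}  refl refl refl e = ⊥-elim (rotate-no-fixpoint _ (sym e))
congruent-outer-rises {false} {false} {false} {false} refl refl refl e = ⊥-elim (rotate²-no-fixpoint _ (sym e))
congruent-outer-rises {true}  {true}  {true}  {true}  refl refl refl e = refl , refl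
congruent-outer-rises {true}  {true}  {true}  {false} refl refl refl e = ⊥-elim (rotate²-no-fixpoint _ e)
congruent-outer-rises {true}  {true}  {false} {true}  refl refl refl e = ⊥-elim (rotate-no-fixpoint _ (sym e))
congruent-outer-rises {true}  {true}  {false} {false} refl refl refl e = ⊥-elim (rotate²-no-fixpoint _ (sym e))
congruent-outer-rises {true}  {false} {true}  {true}  refl refl refl e = ⊥-elim (rotate²-no-fixpoint _ e)
congruent-outer-rises {true}  {false} {true}  {false} refl refl refl e = ⊥-elim (rotate-no-fixpoint _ e)
congruent-outer-rises {true}  {false} {false} {true}  refl refl refl e = ⊥-elim (rotate²-no-fixpoint _ (sym e))
congruent-outer-rises {true}  {false} {false} {false} refl refl refl e = refl , refl

colourOf : Fin n → Vec ℕ n → Fin (n * 3)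
colourOf i b = combine i (residue (potential i b))

stepColour : {x y : Vec ℕ n} → Step x y → Fin (n * 3)
stepColour s = colourOf (direction s) (lower s)

stepColour-reverse : (s : Step x y) → stepColour (reverse s) ≡ stepColour s
stepColour-reverse (step _ true  _) = refl
stepColour-reverse (step _ false _) = refl

same-colour⇒backtrack : (s : Step x y) (t : Step y z) → stepColour s ≡ stepColour t → x ≡ z
same-colour⇒backtrack {x = x} {y} {z} s@(step i a _) t@(step j b _) eq
  with combine-injective i _ j _ eq
... | refl , same-residue =
  backtracks s t refl (congruent-unit-rises⇒opposite (own-potential-rise s) (own-potential-rise t) lows)
  where
  lows : residue (low a (potential i x) (potential i y)) ≡ residue (low b (potential i y) (potential i z))
  lows = subst₂ (λ p q → residue p ≡ residue q) (potential-lower i s) (potential-lower i t) same-residue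

same-outer-colour : (e₁ : Step v₀ v₁) (e₂ : Step v₁ v₂) (e₃ : Step v₂ v₃) → stepColour e₁ ≡ stepColour e₃ →
                    let h = heavy (direction e₁) (direction e₂) in
                    AgreeIff h (ascending e₁) (ascending e₂) × AgreeIff h (ascending e₂) (ascending e₃)
same-outer-colour {v₀ = v₀} {v₁} {v₂ = v₂} {v₃} e₁@(step i a _) e₂ e₃@(step j c _) eq
  with combine-injective i _ j _ eq
... | refl , same-residue =
  congruent-outer-rises (own-potential-rise e₁) (potential-rise i e₂) (own-potential-rise e₃) lows
  where
  lows : residue (low a (potential i v₀) (potential i v₁)) ≡ residue (low c (potential i v₂) (potential i v₃))
  lows = subst₂ (λ p q → residue p ≡ residue q) (potential-lower i e₁) (potential-lower i e₃) same-residue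

no-alternating-walk : (e₁ : Step v₀ v₁) (e₂ : Step v₁ v₂) (e₃ : Step v₂ v₃) (e₄ : Step v₃ v₄) → v₀ ≢ v₂ →
                      stepColour e₁ ≡ stepColour e₃ → stepColour e₂ ≡ stepColour e₄ → ⊥
no-alternating-walk e₁@(step i a _) e₂@(step j b _) e₃@(step k c _) e₄ v₀≢v₂ c₁₃ c₂₄
  with combine-injective i _ k _ c₁₃ | i Fin.≟ j
... | refl , _ | yes refl =
  v₀≢v₂ (backtracks e₁ e₂ refl
          (subst (λ h → AgreeIff h a b) (heavy-irrefl i) (proj₁ (same-outer-colour e₁ e₂ e₃ c₁₃))))
... | refl , _ | no i≢j =
  AgreeIff-not (proj₂ (same-outer-colour e₁ e₂ e₃ c₁₃))
               (subst (λ h → AgreeIff h b c) (heavy-flip i≢j) (proj₁ (same-outer-colour e₂ e₃ e₄ c₂₄)))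

firstDifference : Vec ℕ n → Vec ℕ n → Maybe (Fin n)
firstDifference []      []      = nothing
firstDifference (a ∷ x) (b ∷ y) with a ℕ.≟ b
... | yes _ = Maybe.map suc (firstDifference x y)
... | no  _ = just zero

firstDifference-↑ : ∀ (x : Vec ℕ n) i →
                    firstDifference x (x ↑ i) ≡ just i × firstDifference (x ↑ i) x ≡ just i
firstDifference-↑ (a ∷ x) zero with a ℕ.≟ suc a | suc a ℕ.≟ a
... | yes a≡1+a | _         = ⊥-elim (1+n≢n (sym a≡1+a))
... | no _      | yes 1+a≡a = ⊥-elim (1+n≢n 1+a≡a)
... | no _      | no _      = refl , refl
firstDifference-↑ (a ∷ x) (suc i) with a ℕ.≟ a | firstDifference-↑ x i
... | yes _ | forth , back = cong (Maybe.map suc) forth , cong (Maybe.map suc) back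
... | no a≢a | _          = ⊥-elim (a≢a refl)

meet-↑ : ∀ (x : Vec ℕ n) i → zipWith _⊓_ x (x ↑ i) ≡ x × zipWith _⊓_ (x ↑ i) x ≡ x
meet-↑ (a ∷ x) zero    = cong₂ _∷_ (m≤n⇒m⊓n≡m (n≤1+n a)) (zipWith-idem ⊓-idem x)
                       , cong₂ _∷_ (m≥n⇒m⊓n≡n (n≤1+n a)) (zipWith-idem ⊓-idem x)
meet-↑ (a ∷ x) (suc i) = cong₂ _∷_ (⊓-idem a) (proj₁ (meet-↑ x i)) , cong₂ _∷_ (⊓-idem a) (proj₂ (meet-↑ x i))

-- Only its values on edges matter; elsewhere the direction defaults to 0.
colour : Vec ℕ (suc n) → Vec ℕ (suc n) → Fin (suc n * 3)
colour x y = colourOf (fromMaybe zero (firstDifference x y)) (zipWith _⊓_ x y)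

colour-step : (s : Step x y) → colour x y ≡ stepColour s
colour-step {x = x} (step i true refl) =
  cong₂ colourOf (cong (fromMaybe zero) (proj₁ (firstDifference-↑ x i))) (proj₁ (meet-↑ x i))
colour-step {y = y} (step i false refl) =
  cong₂ colourOf (cong (fromMaybe zero) (proj₂ (firstDifference-↑ y i))) (proj₂ (meet-↑ y i))

colour-isStar : ∀ {n} (l : Vec ℕ (suc n)) → IsStarEdgeColoring l (suc n * 3) colour
colour-isStar {n} l = record { symmetric = symmetric ; proper = proper ; star = star }
  where
  symmetric : ∀ x y → Adj l x y → colour x y ≡ colour y x
  symmetric x y xy = begin
    colour x y            ≡⟨ colour-step s ⟩
    stepColour s          ≡⟨ stepColour-reverse s ⟨
    stepColour (reverse s) ≡⟨ colour-step (reverse s) ⟨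
    colour y x            ∎
    where
    open ≡-Reasoning
    s : Step x y
    s = adj⇒step xy

  proper : ∀ x y z → Adj l x y → Adj l x z → y ≢ z → colour x y ≢ colour x z
  proper x y z xy xz y≢z eq = y≢z (same-colour⇒backtrack (reverse s) t
    (trans (stepColour-reverse s) (trans (sym (colour-step s)) (trans eq (colour-step t)))))
    where
    s : Step x y
    s = adj⇒step xy
    t : Step x z
    t = adj⇒step xz

  star : StarCondition l (suc n * 3) colour
  star v₀ v₁ v₂ v₃ v₄ a₀₁ a₁₂ a₂₃ a₃₄ _ v₀≢v₂ _ _ v₁≢v₃ _ _ v₄≢v₂ _ (a , b , m₁ , m₂ , m₃ , m₄) =
    no-alternating-walk e₁ e₂ e₃ e₄ v₀≢v₂
      (alternates (on e₁ m₁) (on e₂ m₂) (on e₃ m₃) (differ e₁ e₂ v₀≢v₂) (differ e₂ e₃ v₁≢v₃))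
      (alternates (on e₂ m₂) (on e₃ m₃) (on e₄ m₄) (differ e₂ e₃ v₁≢v₃) (differ e₃ e₄ (v₄≢v₂ ∘ sym)))
    where
    e₁ : Step v₀ v₁
    e₁ = adj⇒step a₀₁
    e₂ : Step v₁ v₂
    e₂ = adj⇒step a₁₂
    e₃ : Step v₂ v₃
    e₃ = adj⇒step a₂₃
    e₄ : Step v₃ v₄
    e₄ = adj⇒step a₃₄
    on : ∀ {x y : Vec ℕ (suc n)} (e : Step x y) →
         colour x y ≡ a ⊎ colour x y ≡ b → stepColour e ≡ a ⊎ stepColour e ≡ b
    on e = subst (λ c → c ≡ a ⊎ c ≡ b) (colour-step e)
    differ : ∀ {x y z : Vec ℕ (suc n)} (e : Step x y) (f : Step y z) →
             x ≢ z → stepColour e ≢ stepColour f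
    differ e f x≢z = x≢z ∘ same-colour⇒backtrack e f

-- Deciding star colourability of a finite grid

∀-InGrid? : ∀ (l : Vec ℕ n) {P : Vec ℕ n → Set} → (∀ x → Dec (P x)) → Dec (∀ x → InGrid l x → P x)
∀-InGrid? []      P? = map′ (λ p → λ { [] [] → p }) (λ all → all [] []) (P? [])
∀-InGrid? (n ∷ l) P? = map′ (λ all → λ { (a ∷ x) (a<n ∷ x∈l) → all {a} a<n x x∈l })
                            (λ all {a} a<n x x∈l → all (a ∷ x) (a<n ∷ x∈l))
                            (allUpTo? (λ a → ∀-InGrid? l (P? ∘ (a ∷_))) n)

adj? : ∀ (l x y : Vec ℕ n) → Dec (Adj l x y)
adj? l x y = inGrid? x ×-dec inGrid? y ×-dec any? λ i →
  ((suc (lookup x i) ℕ.≟ lookup y i) ⊎-dec (suc (lookup y i) ℕ.≟ lookup x i)) ×-dec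
  all? (λ j → ¬? (j Fin.≟ i) →-dec (lookup x j ℕ.≟ lookup y j))
  where
  inGrid? : ∀ z → Dec (InGrid l z)
  inGrid? z = Pointwise.decidable _<?_ z l

_≢?_ : (x y : Vec ℕ n) → Dec (x ≢ y)
x ≢? y = ¬? (≡-dec-Vec ℕ._≟_ x y)

module _ (l : Vec ℕ n) where

  ∀-Adj-from? : ∀ x {Q : Vec ℕ n → Set} → (∀ y → Dec (Q y)) → Dec (∀ y → Adj l x y → Q y)
  ∀-Adj-from? x Q? = map′ (λ all y xy → all y (proj₁ (proj₂ xy)) xy) (λ all y _ xy → all y xy)
                          (∀-InGrid? l λ y → adj? l x y →-dec Q? y)

  ∀-Adj? : ∀ {Q : Vec ℕ n → Vec ℕ n → Set} → (∀ x y → Dec (Q x y)) → Dec (∀ x y → Adj l x y → Q x y)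
  ∀-Adj? Q? = map′ (λ all x y xy → all x (proj₁ xy) y xy) (λ all x _ y xy → all x y xy)
                   (∀-InGrid? l λ x → ∀-Adj-from? x (Q? x))

  isStarEdgeColoring? : ∀ k (c : Vec ℕ n → Vec ℕ n → Fin k) → Dec (IsStarEdgeColoring l k c)
  isStarEdgeColoring? k c =
    map′ (λ (s , p , t) → record { symmetric = s ; proper = p ; star = t })
         (λ r → IsStarEdgeColoring.symmetric r , IsStarEdgeColoring.proper r , IsStarEdgeColoring.star r)
         (symmetric? ×-dec proper? ×-dec star?)
    where
    symmetric? : Dec (∀ x y → Adj l x y → c x y ≡ c y x)
    symmetric? = ∀-Adj? λ x y → c x y Fin.≟ c y x
    proper? : Dec (∀ x y z → Adj l x y → Adj l x z → y ≢ z → c x y ≢ c x z)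
    proper? = map′ (λ all x y z xy xz → all x y xy z xz) (λ all x y xy z xz → all x y z xy xz)
                   (∀-Adj? λ x y → ∀-Adj-from? x λ z → y ≢? z →-dec ¬? (c x y Fin.≟ c x z))
    in? : ∀ (e a b : Fin k) → Dec (e ≡ a ⊎ e ≡ b)
    in? e a b = (e Fin.≟ a) ⊎-dec (e Fin.≟ b)
    star? : Dec (StarCondition l k c)
    star? = map′ (λ all v₀ v₁ v₂ v₃ v₄ a₀₁ a₁₂ a₂₃ a₃₄ → all v₀ v₁ a₀₁ v₂ a₁₂ v₃ a₂₃ v₄ a₃₄)
                 (λ all v₀ v₁ a₀₁ v₂ a₁₂ v₃ a₂₃ v₄ a₃₄ → all v₀ v₁ v₂ v₃ v₄ a₀₁ a₁₂ a₂₃ a₃₄)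
      (∀-Adj? λ v₀ v₁ → ∀-Adj-from? v₁ λ v₂ → ∀-Adj-from? v₂ λ v₃ → ∀-Adj-from? v₃ λ v₄ →
        v₀ ≢? v₁ →-dec v₀ ≢? v₂ →-dec v₀ ≢? v₃ →-dec v₁ ≢? v₂ →-dec v₁ ≢? v₃ →-dec v₂ ≢? v₃ →-dec
        v₄ ≢? v₁ →-dec v₄ ≢? v₂ →-dec v₄ ≢? v₃ →-dec
        ¬? (any? λ a → any? λ b → in? (c v₀ v₁) a b ×-dec in? (c v₁ v₂) a b ×-dec
                                  in? (c v₂ v₃) a b ×-dec in? (c v₃ v₄) a b))

Table : Vec ℕ n → Set → Set
Table []      A = A
Table (n ∷ l) A = Vec (Table l A) n

tabulateᵀ : (l : Vec ℕ n) → (Vec ℕ n → A) → Table l A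
tabulateᵀ []      f = f []
tabulateᵀ (n ∷ l) f = tabulate λ a → tabulateᵀ l (f ∘ (toℕ a ∷_))

lookupᵀ : (l : Vec ℕ n) → A → Table l A → Vec ℕ n → A
lookupᵀ []      _       t []      = t
lookupᵀ (n ∷ l) outside t (a ∷ x) with a <? n
... | yes a<n = lookupᵀ l outside (lookup t (fromℕ< a<n)) x
... | no  _   = outside

lookupᵀ∘tabulateᵀ : ∀ (l : Vec ℕ n) (outside : A) f {x} → InGrid l x → lookupᵀ l outside (tabulateᵀ l f) x ≡ f x
lookupᵀ∘tabulateᵀ []      _       f []            = refl
lookupᵀ∘tabulateᵀ (n ∷ l) outside f {a ∷ x} (a<n ∷ x∈l) with a <? n
... | yes a<n′ = begin
  lookupᵀ l outside (lookup (tabulate λ b → tabulateᵀ l (f ∘ (toℕ b ∷_))) (fromℕ< a<n′)) x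
    ≡⟨ cong (λ t → lookupᵀ l outside t x) (lookup∘tabulate _ (fromℕ< a<n′)) ⟩
  lookupᵀ l outside (tabulateᵀ l (f ∘ (toℕ (fromℕ< a<n′) ∷_))) x
    ≡⟨ lookupᵀ∘tabulateᵀ l outside _ x∈l ⟩
  f (toℕ (fromℕ< a<n′) ∷ x)
    ≡⟨ cong (λ b → f (b ∷ x)) (toℕ-fromℕ< a<n′) ⟩
  f (a ∷ x) ∎
  where open ≡-Reasoning
... | no a≮n = contradiction a<n a≮n

Searchable : Set → Set₁
Searchable A = ∀ {P : A → Set} → (∀ a → Dec (P a)) → Dec (Σ A P)

searchable-Vec : Searchable A → ∀ n → Searchable (Vec A n)
searchable-Vec search zero    P? = map′ ([] ,_) (λ { ([] , p) → p }) (P? [])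
searchable-Vec search (suc n) P? =
  map′ (λ (a , as , p) → a ∷ as , p) (λ { (a ∷ as , p) → a , as , p })
       (search λ a → searchable-Vec search n λ as → P? (a ∷ as))

searchable-Table : Searchable A → (l : Vec ℕ n) → Searchable (Table l A)
searchable-Table search []      = search
searchable-Table search (n ∷ l) = searchable-Vec (searchable-Table search l) n

IsStarEdgeColoring-cong : ∀ {l : Vec ℕ n} {k} {c c′ : Vec ℕ n → Vec ℕ n → Fin k} →
                          (∀ x y → InGrid l x → InGrid l y → c x y ≡ c′ x y) →
                          IsStarEdgeColoring l k c → IsStarEdgeColoring l k c′
IsStarEdgeColoring-cong {l = l} {k} {c} {c′} agree isStar = record
  { symmetric = λ x y xy → trans (sym (on xy)) (trans (symmetric x y xy) (on (Adj-sym xy)))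
  ; proper    = λ x y z xy xz y≢z eq → proper x y z xy xz y≢z (trans (on xy) (trans eq (sym (on xz))))
  ; star      = λ v₀ v₁ v₂ v₃ v₄ a₀₁ a₁₂ a₂₃ a₃₄ n₀₁ n₀₂ n₀₃ n₁₂ n₁₃ n₂₃ n₄₁ n₄₂ n₄₃
                  (a , b , m₁ , m₂ , m₃ , m₄) →
      star v₀ v₁ v₂ v₃ v₄ a₀₁ a₁₂ a₂₃ a₃₄ n₀₁ n₀₂ n₀₃ n₁₂ n₁₃ n₂₃ n₄₁ n₄₂ n₄₃
           (a , b , back a₀₁ m₁ , back a₁₂ m₂ , back a₂₃ m₃ , back a₃₄ m₄)
  }
  where
  open IsStarEdgeColoring isStar
  on : ∀ {x y} → Adj l x y → c x y ≡ c′ x y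
  on {x} {y} (x∈l , y∈l , _) = agree x y x∈l y∈l
  back : ∀ {x y a b} → Adj l x y → c′ x y ≡ a ⊎ c′ x y ≡ b → c x y ≡ a ⊎ c x y ≡ b
  back xy = subst (λ e → e ≡ _ ⊎ e ≡ _) (sym (on xy))

starColorable? : ∀ (l : Vec ℕ n) k → Dec (StarColorable l k)
starColorable? {n} l zero    = no λ (c , _) → ¬Fin0 (c (replicate n 0) (replicate n 0))
starColorable? {n} l (suc k) =
  map′ (λ (t , isStar) → fromTable t , isStar)
       (λ (c , isStar) → toTable c , IsStarEdgeColoring-cong (agree c) isStar)
       (searchable-Table (searchable-Table any? l) l λ t → isStarEdgeColoring? l (suc k) (fromTable t))
  where
  fromTable : Table l (Table l (Fin (suc k))) → Vec ℕ n → Vec ℕ n → Fin (suc k)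
  fromTable t x = lookupᵀ l zero (lookupᵀ l (tabulateᵀ l λ _ → zero) t x)
  toTable : (Vec ℕ n → Vec ℕ n → Fin (suc k)) → Table l (Table l (Fin (suc k)))
  toTable c = tabulateᵀ l λ x → tabulateᵀ l (c x)
  agree : ∀ c x y → InGrid l x → InGrid l y → c x y ≡ fromTable (toTable c) x y
  agree c x y x∈l y∈l = sym (begin
    lookupᵀ l zero (lookupᵀ l _ (tabulateᵀ l λ x → tabulateᵀ l (c x)) x) y
      ≡⟨ cong (λ t → lookupᵀ l zero t y) (lookupᵀ∘tabulateᵀ l _ _ x∈l) ⟩
    lookupᵀ l zero (tabulateᵀ l (c x)) y
      ≡⟨ lookupᵀ∘tabulateᵀ l zero (c x) y∈l ⟩
    c x y ∎)
    where open ≡-Reasoning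

Least : (ℕ → Set) → ℕ → Set
Least P k = P k × (∀ m → P m → k ≤ m)

least-satisfying : ∀ {P : ℕ → Set} → (∀ n → Dec (P n)) → ∀ K → P K → ∃[ k ] (Least P k × k ≤ K)
least-satisfying {P} P? = <-rec _ least
  where
  least : ∀ K → (∀ {n} → n < K → P n → ∃[ k ] (Least P k × k ≤ n)) → P K → ∃[ k ] (Least P k × k ≤ K)
  least K below pK with anyUpTo? P? K
  ... | no none = K , (pK , λ m pm → ≮⇒≥ λ m<K → none (m , m<K , pm)) , ≤-refl
  ... | yes (n , n<K , pn) with below n<K pn
  ...   | k , spec , k≤n = k , spec , ≤-trans k≤n (<⇒≤ n<K)

-- No star edge colouring of P₄ □ P₄ with five colours

G₄ : Vec ℕ 2
G₄ = 4 ∷ 4 ∷ []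

Vertex : Set
Vertex = Vec ℕ 2

vertices : List Vertex
vertices = concatMap (λ a → map (λ b → a ∷ b ∷ []) (upTo 4)) (upTo 4)

directions : List (Fin 2)
directions = zero ∷ suc zero ∷ []

upward : Vertex → List Vertex
upward x = concatMap (λ i → if suc (lookup x i) <ᵇ 4 then x ↑ i ∷ [] else []) directions

neighbours : Vertex → List Vertex
neighbours x = concatMap (λ i → if 0 <ᵇ lookup x i then x [ i ]%= ℕ.pred ∷ [] else []) directions ++ upward x

edges : List (Vertex × Vertex)
edges = concatMap (λ s → filterᵇ (λ (_ , y) → height y ≡ᵇ s) lexicographic) (upTo 4)
  where
  height : Vertex → ℕ
  height (a ∷ b ∷ []) = a ⊔ b
  lexicographic : List (Vertex × Vertex)
  lexicographic = concatMap (λ x → map (x ,_) (upward x)) vertices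

_==_ : Vertex → Vertex → Bool
(a ∷ b ∷ []) == (c ∷ d ∷ []) = (a ≡ᵇ c) ∧ (b ≡ᵇ d)
infix 7 _==_

-- Past the end of the list it returns an arbitrary edge of G₄.
nth : List (Vertex × Vertex) → ℕ → Vertex × Vertex
nth []       _       = 0 ∷ 0 ∷ [] , 1 ∷ 0 ∷ []
nth (e ∷ es) zero    = e
nth (e ∷ es) (suc a) = nth es a

data Constraint : Set where
  fork : (x y z : Vertex) (a b : ℕ) → Constraint
  path : (v₀ v₁ v₂ v₃ v₄ : Vertex) (a b c d : ℕ) → Constraint

Colouring : Set
Colouring = ℕ → Fin 5

Holds : Colouring → Constraint → Set
Holds ρ (fork _ _ _ a b)         = ρ a ≢ ρ b
Holds ρ (path _ _ _ _ _ a b c d) = ¬ (ρ a ≡ ρ c × ρ b ≡ ρ d)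

holds? : ∀ ρ C → Dec (Holds ρ C)
holds? ρ (fork _ _ _ a b)         = ¬? (ρ a Fin.≟ ρ b)
holds? ρ (path _ _ _ _ _ a b c d) = ¬? ((ρ a Fin.≟ ρ c) ×-dec (ρ b Fin.≟ ρ d))

Bounded : ℕ → Constraint → Set
Bounded k (fork _ _ _ a b)         = a ≤ k × b ≤ k
Bounded k (path _ _ _ _ _ a b c d) = a ≤ k × b ≤ k × c ≤ k × d ≤ k

bounded? : ∀ k C → Dec (Bounded k C)
bounded? k (fork _ _ _ a b)         = a ≤? k ×-dec b ≤? k
bounded? k (path _ _ _ _ _ a b c d) = a ≤? k ×-dec b ≤? k ×-dec c ≤? k ×-dec d ≤? k

Layered : ℕ → List (List Constraint) → Set
Layered k []       = ⊤
Layered k (B ∷ Bs) = ListAll.All (Bounded k) B × Layered (suc k) Bs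

layered? : ∀ k Bs → Dec (Layered k Bs)
layered? k []       = yes tt
layered? k (B ∷ Bs) = ListAll.all? (bounded? k) B ×-dec layered? (suc k) Bs

-- Constraints refer to edges by their position in es.  The table below is produced by plain
-- enumeration, bucket k holding the constraints whose largest edge index is k; none of this
-- is trusted, since `certificate` checks every constraint against the grid.
module _ (es : List (Vertex × Vertex)) where

  EdgeIs : ℕ → Vertex → Vertex → Set
  EdgeIs a x y = nth es a ≡ (x , y) ⊎ nth es a ≡ (y , x)

  edgeIs? : ∀ a x y → Dec (EdgeIs a x y)
  edgeIs? a x y = (nth es a ≟ₑ (x , y)) ⊎-dec (nth es a ≟ₑ (y , x))
    where
    _≟ₑ_ : (e f : Vertex × Vertex) → Dec (e ≡ f)
    _≟ₑ_ = Product.≡-dec (≡-dec-Vec ℕ._≟_) (≡-dec-Vec ℕ._≟_)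

  Valid : Constraint → Set
  Valid (fork x y z a b) = y ≢ z × EdgeIs a x y × EdgeIs b x z
  Valid (path v₀ v₁ v₂ v₃ v₄ a b c d) =
    v₀ ≢ v₁ × v₀ ≢ v₂ × v₀ ≢ v₃ × v₁ ≢ v₂ × v₁ ≢ v₃ × v₂ ≢ v₃ × v₄ ≢ v₁ × v₄ ≢ v₂ × v₄ ≢ v₃ ×
    EdgeIs a v₀ v₁ × EdgeIs b v₁ v₂ × EdgeIs c v₂ v₃ × EdgeIs d v₃ v₄

  valid? : ∀ C → Dec (Valid C)
  valid? (fork x y z a b) = y ≢? z ×-dec edgeIs? a x y ×-dec edgeIs? b x z
  valid? (path v₀ v₁ v₂ v₃ v₄ a b c d) =
    v₀ ≢? v₁ ×-dec v₀ ≢? v₂ ×-dec v₀ ≢? v₃ ×-dec v₁ ≢? v₂ ×-dec v₁ ≢? v₃ ×-dec v₂ ≢? v₃ ×-dec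
    v₄ ≢? v₁ ×-dec v₄ ≢? v₂ ×-dec v₄ ≢? v₃ ×-dec
    edgeIs? a v₀ v₁ ×-dec edgeIs? b v₁ v₂ ×-dec edgeIs? c v₂ v₃ ×-dec edgeIs? d v₃ v₄

  index : Vertex → Vertex → ℕ
  index x y = position es
    where
    position : List (Vertex × Vertex) → ℕ
    position []             = 0
    position ((u , v) ∷ es) = if u == x ∧ v == y ∨ u == y ∧ v == x then 0 else suc (position es)

  forks : List Constraint
  forks = concatMap (λ x → concatMap (λ y → concatMap (λ z → fork-if x y z (index x y) (index x z))
          (neighbours x)) (neighbours x)) vertices
    where
    fork-if : Vertex → Vertex → Vertex → ℕ → ℕ → List Constraint
    fork-if x y z a b = if a <ᵇ b then fork x y z a b ∷ [] else []

  paths : List Constraint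
  paths = concatMap (λ v₀ → concatMap (λ v₁ → concatMap (λ v₂ → concatMap (λ v₃ → concatMap (λ v₄ →
            if not (v₀ == v₂ ∨ v₀ == v₃ ∨ v₁ == v₃ ∨ v₄ == v₁ ∨ v₄ == v₂)
            then path-if v₀ v₁ v₂ v₃ v₄ (index v₀ v₁) (index v₁ v₂) (index v₂ v₃) (index v₃ v₄) else [])
          (neighbours v₃)) (neighbours v₂)) (neighbours v₁)) (neighbours v₀)) vertices
    where
    path-if : Vertex → Vertex → Vertex → Vertex → Vertex → ℕ → ℕ → ℕ → ℕ → List Constraint
    path-if v₀ v₁ v₂ v₃ v₄ a b c d = if a <ᵇ d then path v₀ v₁ v₂ v₃ v₄ a b c d ∷ [] else []

  constraintTable : List (List Constraint)
  constraintTable = map (λ k → filterᵇ (λ C → top C ≡ᵇ k) (forks ++ paths)) (upTo (length es))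
    where
    top : Constraint → ℕ
    top (fork _ _ _ a b)         = a ⊔ b
    top (path _ _ _ _ _ a b c d) = a ⊔ b ⊔ c ⊔ d

_[_≔_] : Colouring → ℕ → Fin 5 → Colouring
(ρ [ k ≔ c ]) e = if does (e ℕ.≟ k) then c else ρ e

-- Colourings in canonical form: with the colours of edges 0 … k−1 drawn from the first `used`
-- ones, edge k gets one of these or the least unused colour.
Extendable : List (List Constraint) → ℕ → Colouring → ℕ → Set
Extendable []       k ρ used = ⊤
Extendable (B ∷ Bs) k ρ used =
  ∃[ c ] (toℕ c ≤ used × ListAll.All (Holds (ρ [ k ≔ c ])) B ×
          Extendable Bs (suc k) (ρ [ k ≔ c ]) (used ⊔ suc (toℕ c)))

extendable? : ∀ Bs k ρ used → Dec (Extendable Bs k ρ used)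
extendable? []       k ρ used = yes tt
extendable? (B ∷ Bs) k ρ used = any? λ c →
  (toℕ c ≤? used) ×-dec ListAll.all? (holds? (ρ [ k ≔ c ])) B ×-dec
  extendable? Bs (suc k) (ρ [ k ≔ c ]) (used ⊔ suc (toℕ c))

record Certificate (es : List (Vertex × Vertex)) (Bs : List (List Constraint)) : Set where
  field
    layered      : Layered 0 Bs
    valid        : ListAll.All (ListAll.All (Valid es)) Bs
    unextendable : ¬ Extendable Bs 0 (λ _ → zero) 0

certificate? : ∀ es Bs → Dec (Certificate es Bs)
certificate? es Bs =
  map′ (λ (l , v , u) → record { layered = l ; valid = v ; unextendable = u })
       (λ c → Certificate.layered c , Certificate.valid c , Certificate.unextendable c)
       (layered? 0 Bs ×-dec ListAll.all? (ListAll.all? (valid? es)) Bs ×-dec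
        ¬? (extendable? Bs 0 (λ _ → zero) 0))

-- Checking `refl : isYes a? ≡ true` runs Agda's fast evaluator on a?; checking `tt : True a?`
-- instead goes through unification and is several times slower on the certificate.
by-evaluation : ∀ {A : Set} (a? : Dec A) → isYes a? ≡ true → A
by-evaluation a? evaluates-to-true = toWitness {a? = a?} (subst T (sym evaluates-to-true) tt)

certificate : Certificate edges (constraintTable edges)
certificate = by-evaluation (certificate? edges (constraintTable edges)) refl

Holds-agree : ∀ {k ρ σ} C → Bounded k C → (∀ e → e ≤ k → ρ e ≡ σ e) → Holds σ C → Holds ρ C
Holds-agree (fork _ _ _ a b) (a≤k , b≤k) agree holds
  rewrite agree a a≤k | agree b b≤k = holds
Holds-agree (path _ _ _ _ _ a b c d) (a≤k , b≤k , c≤k , d≤k) agree holds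
  rewrite agree a a≤k | agree b b≤k | agree c c≤k | agree d d≤k = holds

Holds-injective : ∀ {ρ} (π : Fin 5 → Fin 5) → (∀ {c c′} → π c ≡ π c′ → c ≡ c′) →
                  ∀ C → Holds ρ C → Holds (π ∘ ρ) C
Holds-injective π injective (fork _ _ _ a b)         holds = holds ∘ injective
Holds-injective π injective (path _ _ _ _ _ a b c d) holds (ac , bd) = holds (injective ac , injective bd)

update-at : ∀ ρ k c → (ρ [ k ≔ c ]) k ≡ c
update-at ρ k c rewrite dec-true (k ℕ.≟ k) refl = refl

update-elsewhere : ∀ ρ {k e} c → e ≢ k → (ρ [ k ≔ c ]) e ≡ ρ e
update-elsewhere ρ {k} {e} c e≢k rewrite dec-false (e ℕ.≟ k) e≢k = refl

transpose-injective : ∀ {n} (i j : Fin n) {c c′} → transpose i j c ≡ transpose i j c′ → c ≡ c′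
transpose-injective i j {c} {c′} eq =
  trans (sym (transpose-inverse j i)) (trans (cong (transpose j i) eq) (transpose-inverse j i))

transpose-hits : ∀ {n} (i j : Fin n) → transpose i j i ≡ j
transpose-hits i j rewrite dec-true (i Fin.≟ i) refl = refl

transpose-fixes : ∀ {n} {i j c : Fin n} → c ≢ i → c ≢ j → transpose i j c ≡ c
transpose-fixes {i = i} {j} {c} c≢i c≢j rewrite dec-false (c Fin.≟ i) c≢i | dec-false (c Fin.≟ j) c≢j = refl

_≐_below_ : Colouring → Colouring → ℕ → Set
ρ ≐ σ below k = ∀ e → e < k → ρ e ≡ σ e

Fresh : ℕ → Colouring → ℕ → Set
Fresh k ρ used = ∀ e → e < k → toℕ (ρ e) < used

-- If edge k's colour σ k is neither used yet nor the least unused colour, swapping the two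
-- in σ brings σ back into canonical form.
canonical-extension : ∀ Bs k ρ used σ → Layered k Bs → ListAll.All (ListAll.All (Holds σ)) Bs →
                      ρ ≐ σ below k → Fresh k ρ used → Extendable Bs k ρ used
extend-by : ∀ B Bs k ρ used σ → Layered k (B ∷ Bs) → ListAll.All (ListAll.All (Holds σ)) (B ∷ Bs) →
            ρ ≐ σ below k → Fresh k ρ used → toℕ (σ k) ≤ used → Extendable (B ∷ Bs) k ρ used

canonical-extension []       k ρ used σ _       _     _     _     = tt
canonical-extension (B ∷ Bs) k ρ used σ layered holds agree fresh with toℕ (σ k) ≤? used
... | yes fits = extend-by B Bs k ρ used σ layered holds agree fresh fits
... | no ¬fits =
  extend-by B Bs k ρ used (π ∘ σ) layered permuted agree′ fresh fits′
  where
  used<σk : used < toℕ (σ k)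
  used<σk = ≰⇒> ¬fits
  used<5 : used < 5
  used<5 = <-trans used<σk (toℕ<n (σ k))
  new : Fin 5
  new = fromℕ< used<5
  π : Fin 5 → Fin 5
  π = transpose (σ k) new
  permuted : ListAll.All (ListAll.All (Holds (π ∘ σ))) (B ∷ Bs)
  permuted = ListAll.map (ListAll.map (Holds-injective π (transpose-injective (σ k) new) _)) holds
  fits′ : toℕ (π (σ k)) ≤ used
  fits′ = ≤-reflexive (trans (cong toℕ (transpose-hits (σ k) new)) (toℕ-fromℕ< used<5))
  agree′ : ρ ≐ π ∘ σ below k
  agree′ e e<k = trans (agree e e<k) (sym (transpose-fixes σe≢σk σe≢new))
    where
    σe<used : toℕ (σ e) < used
    σe<used = subst (λ c → toℕ c < used) (agree e e<k) (fresh e e<k)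
    σe≢σk : σ e ≢ σ k
    σe≢σk eq = <-asym used<σk (subst (λ c → toℕ c < used) eq σe<used)
    σe≢new : σ e ≢ new
    σe≢new eq = <-irrefl (trans (cong toℕ eq) (toℕ-fromℕ< used<5)) σe<used

extend-by B Bs k ρ used σ (B≤k , layered) (holdsB ∷ holds) agree fresh fits =
  σ k , fits , ListAll.zipWith (λ (bounded , holds) → Holds-agree _ bounded agree′ holds) (B≤k , holdsB) ,
  canonical-extension Bs (suc k) ρ′ (used ⊔ suc (toℕ (σ k))) σ layered holds agree″ fresh′
  where
  ρ′ : Colouring
  ρ′ = ρ [ k ≔ σ k ]
  agree′ : ∀ e → e ≤ k → ρ′ e ≡ σ e
  agree′ e e≤k with m≤n⇒m<n∨m≡n e≤k
  ... | inj₁ e<k  = trans (update-elsewhere ρ _ (λ { refl → <-irrefl refl e<k })) (agree e e<k)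
  ... | inj₂ refl = update-at ρ e (σ e)
  agree″ : ρ′ ≐ σ below suc k
  agree″ e e<1+k = agree′ e (≤-pred e<1+k)
  fresh′ : Fresh (suc k) ρ′ (used ⊔ suc (toℕ (σ k)))
  fresh′ e (s≤s e≤k) with m≤n⇒m<n∨m≡n e≤k
  ... | inj₁ e<k  = subst (λ c → toℕ c < _) (sym (update-elsewhere ρ (σ k) (λ { refl → <-irrefl refl e<k })))
                          (m≤n⇒m≤n⊔o (suc (toℕ (σ k))) (fresh e e<k))
  ... | inj₂ refl = subst (λ c → toℕ c < _) (sym (update-at ρ e (σ e))) (m≤n⇒m≤o⊔n used ≤-refl)

edges-adjacent : ∀ a → Adj G₄ (proj₁ (nth edges a)) (proj₂ (nth edges a))
edges-adjacent = nth-adjacent edges (by-evaluation (ListAll.all? (λ (x , y) → adj? G₄ x y) edges) refl)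
  where
  nth-adjacent : ∀ es → ListAll.All (λ (x , y) → Adj G₄ x y) es →
                 ∀ a → Adj G₄ (proj₁ (nth es a)) (proj₂ (nth es a))
  nth-adjacent []             []         _       = by-evaluation (adj? G₄ (0 ∷ 0 ∷ []) (1 ∷ 0 ∷ [])) refl
  nth-adjacent (e ∷ es)       (xy ∷ _)   zero    = xy
  nth-adjacent (e ∷ es)       (_ ∷ rest) (suc a) = nth-adjacent es rest a

P₄□P₄-not-5-colourable : ¬ StarColorable G₄ 5
P₄□P₄-not-5-colourable (κ , isStar) =
  unextendable (canonical-extension _ 0 (λ _ → zero) 0 σ layered
                  (ListAll.map (ListAll.map (valid⇒holds _)) valid) (λ _ ()) (λ _ ()))
  where
  open IsStarEdgeColoring isStar
  open Certificate certificate
  σ : Colouring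
  σ a = κ (proj₁ (nth edges a)) (proj₂ (nth edges a))
  edge : ∀ a {x y} → EdgeIs edges a x y → Adj G₄ x y × σ a ≡ κ x y
  edge a (inj₁ refl) = edges-adjacent a , refl
  edge a (inj₂ refl) = Adj-sym (edges-adjacent a) , symmetric _ _ (edges-adjacent a)
  valid⇒holds : ∀ C → Valid edges C → Holds σ C
  valid⇒holds (fork x y z a b) (y≢z , xy , xz) σa≡σb with edge a xy | edge b xz
  ... | axy , σa≡κxy | axz , σb≡κxz = proper x y z axy axz y≢z (trans (sym σa≡κxy) (trans σa≡σb σb≡κxz))
  valid⇒holds (path v₀ v₁ v₂ v₃ v₄ a b c d)
              (n₀₁ , n₀₂ , n₀₃ , n₁₂ , n₁₃ , n₂₃ , n₄₁ , n₄₂ , n₄₃ , e₀₁ , e₁₂ , e₂₃ , e₃₄) (σa≡σc , σb≡σd)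
    with edge a e₀₁ | edge b e₁₂ | edge c e₂₃ | edge d e₃₄
  ... | a₀₁ , σa≡κ₀₁ | a₁₂ , σb≡κ₁₂ | a₂₃ , σc≡κ₂₃ | a₃₄ , σd≡κ₃₄ =
    star v₀ v₁ v₂ v₃ v₄ a₀₁ a₁₂ a₂₃ a₃₄ n₀₁ n₀₂ n₀₃ n₁₂ n₁₃ n₂₃ n₄₁ n₄₂ n₄₃
         (κ v₀ v₁ , κ v₁ v₂ , inj₁ refl , inj₂ refl ,
          inj₁ (trans (sym σc≡κ₂₃) (trans (sym σa≡σc) σa≡κ₀₁)) ,
          inj₂ (trans (sym σd≡κ₃₄) (trans (sym σb≡σd) σb≡κ₁₂)))

3d≤4d∸2 : ∀ d → suc (suc d) * 3 ≤ 4 * suc (suc d) ∸ 2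
3d≤4d∸2 d = subst (_≤ d + 3 * suc (suc d)) (*-comm 3 (suc (suc d))) (m≤n+m (3 * suc (suc d)) d)

at-least-6 : ∀ {l₁ l₂} → 4 ≤ l₁ → 4 ≤ l₂ → ∀ m → StarColorable (l₁ ∷ l₂ ∷ []) m → 6 ≤ m
at-least-6 4≤l₁ 4≤l₂ m (c , isStar) with m ≤? 5
... | no  m≰5 = ≰⇒> m≰5
... | yes m≤5 = ⊥-elim (P₄□P₄-not-5-colourable
                  (StarColorable-mono m≤5 (c , IsStarEdgeColoring-mono (4≤l₁ ∷ 4≤l₂ ∷ []) isStar)))

corollary3 : (∀ (d : ℕ) → 2 ≤ d → (l : Vec ℕ d) → All (2 ≤_) l →
    ∃[ k ] (StarChromaticIndex l k × k ≤ 4 * d ∸ 2))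
    × (∀ (l₁ l₂ : ℕ) → 4 ≤ l₁ → 4 ≤ l₂ →
    StarChromaticIndex (l₁ ∷ l₂ ∷ []) 6)
corollary3 = upper-bound , exact-value
  where
  -- The colouring works for every side length.
  upper-bound : ∀ d → 2 ≤ d → (l : Vec ℕ d) → All (2 ≤_) l → ∃[ k ] (StarChromaticIndex l k × k ≤ 4 * d ∸ 2)
  upper-bound 0             ()
  upper-bound 1             (s≤s ())
  upper-bound (suc (suc d)) _ l _ with least-satisfying (starColorable? l) _ (colour , colour-isStar l)
  ... | k , index , k≤3d = k , index , ≤-trans k≤3d (3d≤4d∸2 d)
  exact-value : ∀ l₁ l₂ → 4 ≤ l₁ → 4 ≤ l₂ → StarChromaticIndex (l₁ ∷ l₂ ∷ []) 6
  exact-value l₁ l₂ 4≤l₁ 4≤l₂ = (colour , colour-isStar (l₁ ∷ l₂ ∷ [])) , at-least-6 4≤l₁ 4≤l₂
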